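{- Let $H$ be a finite graph and $\mu(H)$ as in the context. Let $G$ be a subgraph of a Cartesian product $\Gamma=G_1\square\cdots\square G_m$ of finite connected graphs none of which contains $H$ as a minor. Then $\mathrm{vcdens}^*(G)\le\frac{\mu(H)}{2}\cdot\mathrm{vcd}^*(G)$, both computed with respect to $\Gamma$.
   Context: All graphs finite, simple, undirected. The Cartesian product has vertex set $V(G_1)\times\cdots\times V(G_m)$, two tuples adjacent iff they differ in exactly one coordinate $j$ where they are adjacent in $G_j$. $\mu(H)$ is a constant such that every finite graph without $H$ as a minor has average degree $2|E|/|V|$ at most $\mu(H)$. For a graph $F$, $\mathrm{dens}(F)=\max|E(F')|/|V(F')|$ over subgraphs $F'$. Minor-subproducts: for each $i$, let $\mathcal P_i=\{P^i_1,\ldots,P^i_{t_i}\}$ be a partition of $V(G_i)$ into sets inducing connected subgraphs of $G_i$, and $M_i$ a graph on vertex set $\mathcal P_i$ such that parts adjacent in $M_i$ are joined by an edge of $G_i$; $M=M_1\square\cdots\square M_m$ is a minor-subproduct of $\Gamma$, shattered by $G$ if each set $P^1_{l_1}\times\cdots\times P^m_{l_m}$ contains a vertex of $G$. A factor is non-trivial if it has at least two vertices. $\mathrm{vcd}^*(G)$ is the largest number of non-trivial factors of a minor-subproduct shattered by $G$; $\mathrm{vcdens}^*(G)$ is the largest $\mathrm{dens}(M)$ over minor-subproducts $M$ shattered by $G$.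
   Formalization: The constant $\mu(H)$ is rational. -}

module Defs where

open import Data.Nat using (ℕ; zero; suc; _+_; _<ᵇ_; _≤ᵇ_)
open import Data.Bool using (Bool; true; false; _∧_; if_then_else_)
open import Data.Fin using (Fin; toℕ)
open import Data.Maybe using (Maybe; just)
open import Data.Product using (Σ; ∃; ∃₂; _×_)
open import Data.Unit using (⊤)
open import Relation.Binary.PropositionalEquality using (_≡_; _≢_)

sumFin : (n : ℕ) → (Fin n → ℕ) → ℕ
sumFin zero    f = 0
sumFin (suc n) f = f Data.Fin.zero + sumFin n (λ i → f (Data.Fin.suc i))

countFin : (n : ℕ) → (Fin n → Bool) → ℕ
countFin n p = sumFin n (λ i → if p i then 1 else 0)

record Graph : Set where
  field
    n          : ℕ
    adj        : Fin n → Fin n → Bool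
    adj-sym    : ∀ i j → adj i j ≡ adj j i
    adj-irrefl : ∀ i → adj i i ≡ false
open Graph public

numEdges : Graph → ℕ
numEdges G = sumFin (n G) (λ i → sumFin (n G) (λ j →
  if (toℕ i <ᵇ toℕ j) ∧ adj G i j then 1 else 0))

data ReachIn (G : Graph) (S : Fin (n G) → Set) : Fin (n G) → Fin (n G) → Set where
  here : ∀ {x} → ReachIn G S x x
  step : ∀ {x y z} → adj G x y ≡ true → S y → ReachIn G S y z → ReachIn G S x z

ConnectedIn : (G : Graph) → (Fin (n G) → Set) → Set
ConnectedIn G S = ∀ x y → S x → S y → ReachIn G S x y

Connected : Graph → Set
Connected G = Fin (n G) × ConnectedIn G (λ _ → ⊤)

-- H is a minor of G: a partial map V(G) → V(H) whose fibres (branch sets)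
-- are non-empty and connected, with an edge of G between the branch sets
-- of any two adjacent vertices of H.
Minor : Graph → Graph → Set
Minor H G = Σ (Fin (n G) → Maybe (Fin (n H))) λ f →
    (∀ v → ∃ λ x → f x ≡ just v)
  × (∀ v → ConnectedIn G (λ x → f x ≡ just v))
  × (∀ u v → adj H u v ≡ true →
       ∃₂ λ x y → f x ≡ just u × f y ≡ just v × adj G x y ≡ true)

ProdV : {m : ℕ} → (Fin m → Graph) → Set
ProdV {m} Gs = (i : Fin m) → Fin (n (Gs i))

ProdAdj : {m : ℕ} → (Gs : Fin m → Graph) → ProdV Gs → ProdV Gs → Set
ProdAdj {m} Gs x y = Σ (Fin m) λ j →
  (adj (Gs j) (x j) (y j) ≡ true) × (∀ i → i ≢ j → x i ≡ y i)

SubgraphOfProd : {m : ℕ} → (F : Graph) → (Gs : Fin m → Graph) →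
                 (Fin (n F) → ProdV Gs) → Set
SubgraphOfProd F Gs φ =
    (∀ a b → (∀ i → φ a i ≡ φ b i) → a ≡ b)
  × (∀ a b → adj F a b ≡ true → ProdAdj Gs (φ a) (φ b))

-- A minor-subproduct M = M_1 □ ... □ M_m of Γ = G_1 □ ... □ G_m.
-- part i sends a vertex of G_i to the index of its part P^i_l; parts are
-- the fibres, non-empty and connected; fac i = M_i is a graph on the parts,
-- adjacent parts being joined by an edge of G_i.
record MinorSubproduct {m : ℕ} (Gs : Fin m → Graph) : Set where
  field
    fac       : Fin m → Graph
    part      : (i : Fin m) → Fin (n (Gs i)) → Fin (n (fac i))
    part-surj : ∀ i (l : Fin (n (fac i))) → ∃ λ v → part i v ≡ l
    part-conn : ∀ i (l : Fin (n (fac i))) → ConnectedIn (Gs i) (λ v → part i v ≡ l)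
    fac-ok    : ∀ i (a b : Fin (n (fac i))) → adj (fac i) a b ≡ true →
                ∃₂ λ u v → part i u ≡ a × part i v ≡ b × adj (Gs i) u v ≡ true
open MinorSubproduct public

nontrivial : {m : ℕ} {Gs : Fin m → Graph} → MinorSubproduct Gs → ℕ
nontrivial {m} M = countFin m (λ i → 2 ≤ᵇ n (fac M i))

Shattered : {m : ℕ} {Gs : Fin m → Graph} → (G : Graph) →
            (Fin (n G) → ProdV Gs) → MinorSubproduct Gs → Set
Shattered G ψ M = ∀ (l : ProdV (fac M)) →
  ∃ λ v → ∀ i → part M i (ψ v i) ≡ l i

module Submission where

open import Defs
open import Data.Nat using (ℕ; _*_; _≤_; _<_)
open import Data.Fin using (Fin)
open import Data.Product using (Σ; ∃; _×_)
open import Relation.Nullary using (¬_)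

open import Level using (Level)
open import Data.Nat using (zero; suc; _+_; _<ᵇ_; _≤ᵇ_; z≤n)
open import Data.Nat.Properties
  using ( +-mono-≤; *-monoʳ-≤; ≤-trans; ≤-reflexive; ≤-antisym; m≤m+n; +-identityʳ
        ; <ᵇ⇒<; <⇒<ᵇ; <⇒≯; ≮⇒≥; module ≤-Reasoning
        ; +-0-commutativeMonoid; +-*-semiring; *-commutativeSemigroup )
open import Data.Fin using (toℕ) renaming (zero to fzero; suc to fsuc)
open import Data.Fin.Properties using (any?; all?; toℕ-injective)
  renaming (_≟_ to _≟ᶠ_; suc-injective to fsuc-injective)
open import Data.Bool using (Bool; true; false; _∧_; T; if_then_else_)
open import Data.Bool.Properties using (∧-idem; ∧-identityʳ; ∧-zeroʳ)
open import Data.Maybe using (Maybe; just; nothing; _>>=_)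
open import Data.Product using (∃₂; _,_; proj₁; proj₂)
open import Relation.Nullary using (Dec; yes; no; does; contradiction)
open import Relation.Nullary.Decidable using (dec-true; does-⇔; ¬?; _→-dec_)
open import Relation.Binary using (Rel; IsDecEquivalence)
open import Relation.Binary.PropositionalEquality
open import Function using (_∘_; mk⇔)
open import Algebra.Properties.CommutativeMonoid.Sum +-0-commutativeMonoid
  using (sum; sum-syntax; sum-cong-≗; ∑-comm; ∑-distrib-+; sum-remove; sum-replicate-zero)
open import Algebra.Properties.Semiring.Sum +-*-semiring using (*-distribˡ-sum; *-distribʳ-sum)
open import Algebra.Properties.CommutativeSemigroup *-commutativeSemigroup using (x∙yz≈y∙xz)

-- Write F ⊆ M₁ □ ⋯ □ M_m (M = the given shattered minor-subproduct,
-- which is also the witness M′).  Every edge of F changes exactly one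
-- coordinate j, and then M_j is non-trivial.  The edges of direction j
-- split into "lines" (vertices agreeing off j); each line embeds into M_j,
-- and M_j is a contraction of G_j, so a line is H-minor-free and has
-- average degree ≤ μ(H) = p/q.  Summing over lines, then over the
-- non-trivial directions, gives  q·2|E(F)| ≤ p·vcd*·|V(F)|.

𝟙 : Bool → ℕ
𝟙 b = if b then 1 else 0

sumFin≡sum : ∀ k (f : Fin k → ℕ) → sumFin k f ≡ sum f
sumFin≡sum zero    f = refl
sumFin≡sum (suc k) f = cong (f fzero +_) (sumFin≡sum k (f ∘ fsuc))

∑-mono : ∀ {k} {f g : Fin k → ℕ} → (∀ i → f i ≤ g i) → sum f ≤ sum g
∑-mono {zero}  f≤g = z≤n
∑-mono {suc k} f≤g = +-mono-≤ (f≤g fzero) (∑-mono (f≤g ∘ fsuc))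

∑-term : ∀ {k} (f : Fin k → ℕ) i → f i ≤ sum f
∑-term {suc k} f i = ≤-trans (m≤m+n (f i) _) (≤-reflexive (sym (sum-remove {i = i} f)))

∑-const-1 : ∀ k → ∑[ i < k ] 1 ≡ k
∑-const-1 zero    = refl
∑-const-1 (suc k) = cong suc (∑-const-1 k)

∑-indicator : ∀ {k} (x : Fin k) → ∑[ l < k ] 𝟙 (does (x ≟ᶠ l)) ≡ 1
∑-indicator {suc k} fzero    = cong suc (sum-replicate-zero k)
∑-indicator {suc k} (fsuc x) = ∑-indicator x

if-∑ : ∀ {k} c (f : Fin k → ℕ) → (if c then sum f else 0) ≡ ∑[ i < k ] (if c then f i else 0)
if-∑ {k} true  f = refl
if-∑ {k} false f = sym (sum-replicate-zero k)

𝟙-≤ : ∀ {b k} → (b ≡ true → 1 ≤ k) → 𝟙 b ≤ k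
𝟙-≤ {false} _   = z≤n
𝟙-≤ {true}  1≤k = 1≤k refl

degSum : Graph → ℕ
degSum X = ∑[ a < n X ] ∑[ b < n X ] 𝟙 (adj X a b)

split-by-order : (X : Graph) (a b : Fin (n X)) →
  𝟙 (adj X a b) ≡ 𝟙 ((toℕ a <ᵇ toℕ b) ∧ adj X a b) + 𝟙 ((toℕ b <ᵇ toℕ a) ∧ adj X a b)
split-by-order X a b with toℕ a <ᵇ toℕ b in a<b | toℕ b <ᵇ toℕ a in b<a
... | true  | true  = contradiction (<ᵇ⇒< (toℕ b) (toℕ a) (subst T (sym b<a) _))
                                   (<⇒≯ (<ᵇ⇒< (toℕ a) (toℕ b) (subst T (sym a<b) _)))
... | true  | false = sym (+-identityʳ _)
... | false | true  = refl
... | false | false = subst (λ c → 𝟙 (adj X a c) ≡ 0) a≡b (cong 𝟙 (adj-irrefl X a))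
  where
  a≡b : a ≡ b
  a≡b = toℕ-injective (≤-antisym (≮⇒≥ (λ b<a′ → subst T b<a (<⇒<ᵇ b<a′)))
                                 (≮⇒≥ (λ a<b′ → subst T a<b (<⇒<ᵇ a<b′))))

handshake : (X : Graph) → degSum X ≡ 2 * numEdges X
handshake X = begin
  ∑[ a < N ] ∑[ b < N ] 𝟙 (adj X a b)
    ≡⟨ sum-cong-≗ {N} (λ a → trans (sum-cong-≗ {N} (split-by-order X a)) (∑-distrib-+ {N} _ _)) ⟩
  ∑[ a < N ] (∑[ b < N ] 𝟙 ((toℕ a <ᵇ toℕ b) ∧ adj X a b) + ∑[ b < N ] 𝟙 ((toℕ b <ᵇ toℕ a) ∧ adj X a b))
    ≡⟨ ∑-distrib-+ {N} _ _ ⟩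
  E + ∑[ a < N ] ∑[ b < N ] 𝟙 ((toℕ b <ᵇ toℕ a) ∧ adj X a b)
    ≡⟨ cong (E +_) (trans (∑-comm {N} {N} _) (sum-cong-≗ {N} λ b → sum-cong-≗ {N} λ a →
         cong (λ e → 𝟙 ((toℕ b <ᵇ toℕ a) ∧ e)) (adj-sym X a b))) ⟩
  E + E
    ≡⟨ cong (E +_) (sym (+-identityʳ E)) ⟩
  2 * E
    ≡⟨ cong (2 *_) (sym numEdges≡E) ⟩
  2 * numEdges X ∎
  where
  open ≡-Reasoning
  N : ℕ
  N = n X
  E : ℕ
  E = ∑[ a < N ] ∑[ b < N ] 𝟙 ((toℕ a <ᵇ toℕ b) ∧ adj X a b)
  numEdges≡E : numEdges X ≡ E
  numEdges≡E = trans (sumFin≡sum N _) (sum-cong-≗ {N} (λ a → sumFin≡sum N _))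

Sparse : ℕ → ℕ → Graph → Set
Sparse p q X = q * (2 * numEdges X) ≤ p * n X

sparse-degSum : ∀ p q (X : Graph) → Sparse p q X → q * degSum X ≤ p * n X
sparse-degSum p q X = subst (λ d → q * d ≤ p * n X) (sym (handshake X))

count : ∀ {k} → (Fin k → Bool) → ℕ
count {k} S = ∑[ i < k ] 𝟙 (S i)

enum-cons : ∀ {c k} (b : Bool) → (Fin c → Fin k) → Fin (𝟙 b + c) → Fin (suc k)
enum-cons true  e fzero    = fzero
enum-cons true  e (fsuc u) = fsuc (e u)
enum-cons false e u        = fsuc (e u)

enum : ∀ {k} (S : Fin k → Bool) → Fin (count S) → Fin k
enum {suc k} S = enum-cons (S fzero) (enum (S ∘ fsuc))

enum-selects : ∀ {k} (S : Fin k → Bool) u → S (enum S u) ≡ true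
enum-selects {suc k} S u with S fzero in S₀
enum-selects {suc k} S fzero    | true  = S₀
enum-selects {suc k} S (fsuc u) | true  = enum-selects (S ∘ fsuc) u
enum-selects {suc k} S u        | false = enum-selects (S ∘ fsuc) u

enum-injective : ∀ {k} (S : Fin k → Bool) u v → enum S u ≡ enum S v → u ≡ v
enum-injective {suc k} S u v eq with S fzero
enum-injective {suc k} S fzero    fzero    eq | true  = refl
enum-injective {suc k} S (fsuc u) (fsuc v) eq | true  =
  cong fsuc (enum-injective (S ∘ fsuc) u v (fsuc-injective eq))
enum-injective {suc k} S u        v        eq | false =
  enum-injective (S ∘ fsuc) u v (fsuc-injective eq)

∑-enum : ∀ {k} (S : Fin k → Bool) (h : Fin k → ℕ) →
  ∑[ u < count S ] h (enum S u) ≡ ∑[ x < k ] (if S x then h x else 0)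
∑-enum {zero}  S h = refl
∑-enum {suc k} S h with S fzero
... | true  = cong (h fzero +_) (∑-enum (S ∘ fsuc) (h ∘ fsuc))
... | false = ∑-enum (S ∘ fsuc) (h ∘ fsuc)

induced : (X : Graph) → (Fin (n X) → Bool) → Graph
induced X S = record
  { n          = count S
  ; adj        = λ u v → adj X (enum S u) (enum S v)
  ; adj-sym    = λ u v → adj-sym X (enum S u) (enum S v)
  ; adj-irrefl = λ u → adj-irrefl X (enum S u)
  }

pairsIn : (X : Graph) → (Fin (n X) → Bool) → ℕ
pairsIn X S = ∑[ a < n X ] ∑[ b < n X ] 𝟙 (adj X a b ∧ S a ∧ S b)

if-if-𝟙 : ∀ x c d → (if c then (if d then 𝟙 x else 0) else 0) ≡ 𝟙 (x ∧ c ∧ d)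
if-if-𝟙 x true  true  = cong 𝟙 (sym (∧-identityʳ x))
if-if-𝟙 x true  false = cong 𝟙 (sym (∧-zeroʳ x))
if-if-𝟙 x false d     = cong 𝟙 (sym (∧-zeroʳ x))

degSum-induced : (X : Graph) (S : Fin (n X) → Bool) → degSum (induced X S) ≡ pairsIn X S
degSum-induced X S = begin
  ∑[ u < count S ] ∑[ v < count S ] 𝟙 (adj X (enum S u) (enum S v))
    ≡⟨ sum-cong-≗ {count S} (λ u → ∑-enum S (λ b → 𝟙 (adj X (enum S u) b))) ⟩
  ∑[ u < count S ] ∑[ b < N ] (if S b then 𝟙 (adj X (enum S u) b) else 0)
    ≡⟨ ∑-enum S (λ a → ∑[ b < N ] (if S b then 𝟙 (adj X a b) else 0)) ⟩
  ∑[ a < N ] (if S a then ∑[ b < N ] (if S b then 𝟙 (adj X a b) else 0) else 0)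
    ≡⟨ sum-cong-≗ {N} (λ a → trans (if-∑ (S a) (λ b → if S b then 𝟙 (adj X a b) else 0))
                        (sum-cong-≗ {N} (λ b → if-if-𝟙 (adj X a b) (S a) (S b)))) ⟩
  pairsIn X S ∎
  where
  open ≡-Reasoning
  N : ℕ
  N = n X

module Partition (X : Graph) {K : ℕ} (label : Fin (n X) → Fin K)
  (label-edge : ∀ a b → adj X a b ≡ true → label a ≡ label b) where

  class : Fin K → Fin (n X) → Bool
  class l a = does (label a ≟ᶠ l)

  edge-in-one-class : ∀ a b → 𝟙 (adj X a b) ≡ ∑[ l < K ] 𝟙 (adj X a b ∧ class l a ∧ class l b)
  edge-in-one-class a b with adj X a b in ab
  ... | false = sym (sum-replicate-zero K)
  ... | true  = sym (begin
    ∑[ l < K ] 𝟙 (class l a ∧ class l b)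
      ≡⟨ sum-cong-≗ {K} (λ l → cong 𝟙 (trans
           (cong (λ c → class l a ∧ does (c ≟ᶠ l)) (sym (label-edge a b ab)))
           (∧-idem (class l a)))) ⟩
    ∑[ l < K ] 𝟙 (class l a)
      ≡⟨ ∑-indicator (label a) ⟩
    1 ∎)
    where open ≡-Reasoning

  degSum-by-class : degSum X ≡ ∑[ l < K ] pairsIn X (class l)
  degSum-by-class = begin
    ∑[ a < N ] ∑[ b < N ] 𝟙 (adj X a b)
      ≡⟨ sum-cong-≗ {N} (λ a → trans (sum-cong-≗ {N} (edge-in-one-class a)) (∑-comm {N} {K} _)) ⟩
    ∑[ a < N ] ∑[ l < K ] ∑[ b < N ] 𝟙 (adj X a b ∧ class l a ∧ class l b)
      ≡⟨ ∑-comm {N} {K} _ ⟩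
    ∑[ l < K ] pairsIn X (class l) ∎
    where
    open ≡-Reasoning
    N : ℕ
    N = n X

  size-by-class : n X ≡ ∑[ l < K ] count (class l)
  size-by-class = begin
    n X                                   ≡⟨ sym (∑-const-1 (n X)) ⟩
    ∑[ a < n X ] 1                        ≡⟨ sum-cong-≗ {n X} (λ a → sym (∑-indicator (label a))) ⟩
    ∑[ a < n X ] ∑[ l < K ] 𝟙 (class l a) ≡⟨ ∑-comm {n X} {K} _ ⟩
    ∑[ l < K ] count (class l)            ∎
    where open ≡-Reasoning

  partition-sparse : ∀ p q → (∀ l → Sparse p q (induced X (class l))) → Sparse p q X
  partition-sparse p q class-sparse = begin
    q * (2 * numEdges X)                          ≡⟨ cong (q *_) (sym (handshake X)) ⟩
    q * degSum X                                  ≡⟨ cong (q *_) degSum-by-class ⟩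
    q * ∑[ l < K ] pairsIn X (class l)            ≡⟨ *-distribˡ-sum {K} q (λ l → pairsIn X (class l)) ⟩
    ∑[ l < K ] (q * pairsIn X (class l))          ≡⟨ sum-cong-≗ {K} (λ l →
                                                       cong (q *_) (sym (degSum-induced X (class l)))) ⟩
    ∑[ l < K ] (q * degSum (induced X (class l))) ≤⟨ ∑-mono (λ l →
                                                       sparse-degSum p q (induced X (class l)) (class-sparse l)) ⟩
    ∑[ l < K ] (p * count (class l))              ≡⟨ sym (*-distribˡ-sum {K} p (λ l → count (class l))) ⟩
    p * ∑[ l < K ] count (class l)                ≡⟨ cong (p *_) (sym size-by-class) ⟩
    p * n X                                       ∎
    where open ≤-Reasoning

record Embedding (Y W : Graph) : Set where
  field
    map       : Fin (n Y) → Fin (n W)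
    injective : ∀ u v → map u ≡ map v → u ≡ v
    preserves : ∀ u v → adj Y u v ≡ true → adj W (map u) (map v) ≡ true

reach-mono : ∀ {X : Graph} {S T : Fin (n X) → Set} → (∀ v → S v → T v) →
  ∀ {x y} → ReachIn X S x y → ReachIn X T x y
reach-mono S⊆T here         = here
reach-mono S⊆T (step a s r) = step a (S⊆T _ s) (reach-mono S⊆T r)

reach-++ : ∀ {X : Graph} {S : Fin (n X) → Set} {x y z} →
  ReachIn X S x y → ReachIn X S y z → ReachIn X S x z
reach-++ here         r′ = r′
reach-++ (step a s r) r′ = step a s (reach-++ r r′)

reach-map : ∀ {Y W : Graph} {S : Fin (n Y) → Set} {T : Fin (n W) → Set}
  (g : Fin (n Y) → Fin (n W)) → (∀ u v → adj Y u v ≡ true → adj W (g u) (g v) ≡ true) →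
  (∀ u → S u → T (g u)) → ∀ {u v} → ReachIn Y S u v → ReachIn W T (g u) (g v)
reach-map g hom S→T here         = here
reach-map g hom S→T (step a s r) = step (hom _ _ a) (S→T _ s) (reach-map g hom S→T r)

-- A minor of Y is a minor of every graph Y embeds into: a vertex of W
-- goes to the branch set of its preimage, if any.
module _ {Y W : Graph} (e : Embedding Y W) where
  open Embedding e

  preimage : Fin (n W) → Maybe (Fin (n Y))
  preimage l with any? (λ u → map u ≟ᶠ l)
  ... | yes (u , _) = just u
  ... | no  _       = nothing

  preimage-map : ∀ u → preimage (map u) ≡ just u
  preimage-map u with any? (λ u′ → map u′ ≟ᶠ map u)
  ... | yes (u′ , eq) = cong just (injective u′ u eq)
  ... | no  none      = contradiction (u , refl) none

  preimage-just : ∀ {l u} → preimage l ≡ just u → map u ≡ l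
  preimage-just {l} eq with any? (λ u → map u ≟ᶠ l)
  preimage-just refl | yes (u , mu≡l) = mu≡l

  minor-embedding : ∀ H → Minor H Y → Minor H W
  minor-embedding H (f , f-onto , f-conn , f-edge) = f′ , onto , conn , edges
    where
    f′ : Fin (n W) → Maybe (Fin (n H))
    f′ l = preimage l >>= f

    f′-map : ∀ u → f′ (map u) ≡ f u
    f′-map u = cong (_>>= f) (preimage-map u)

    f′-just : ∀ {l h} → f′ l ≡ just h → ∃ λ u → map u ≡ l × f u ≡ just h
    f′-just {l} eq with preimage l in pl
    ... | just u = u , preimage-just pl , eq

    onto : ∀ h → ∃ λ l → f′ l ≡ just h
    onto h with f-onto h
    ... | u , fu = map u , trans (f′-map u) fu

    conn : ∀ h → ConnectedIn W (λ l → f′ l ≡ just h)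
    conn h x y fx fy with f′-just fx | f′-just fy
    ... | u , refl , fu | v , refl , fv =
      reach-map map preserves (λ w fw → trans (f′-map w) fw) (f-conn h u v fu fv)

    edges : ∀ h h′ → adj H h h′ ≡ true →
      ∃₂ λ x y → f′ x ≡ just h × f′ y ≡ just h′ × adj W x y ≡ true
    edges h h′ a with f-edge h h′ a
    ... | u , v , fu , fv , auv =
      map u , map v , trans (f′-map u) fu , trans (f′-map v) fv , preserves u v auv

-- W is obtained from X by contracting the connected parts of 'part'; a
-- minor of W is a minor of X (compose the branch map with 'part').
module Contraction {W X : Graph} (part : Fin (n X) → Fin (n W))
  (part-surj : ∀ l → ∃ λ v → part v ≡ l)
  (part-conn : ∀ l → ConnectedIn X (λ v → part v ≡ l))
  (part-edge : ∀ a b → adj W a b ≡ true →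
     ∃₂ λ u v → part u ≡ a × part v ≡ b × adj X u v ≡ true) where

  reach-lift : ∀ {S : Fin (n W) → Set} {l l′} → ReachIn W S l l′ → S l →
    ∀ x y → part x ≡ l → part y ≡ l′ → ReachIn X (λ v → S (part v)) x y
  reach-lift {S} {l} here Sl x y px py =
    reach-mono (λ v pv → subst S (sym pv) Sl) (part-conn l x y px py)
  reach-lift {S} {l} (step a Sw r) Sl x y px py with part-edge _ _ a
  ... | u , v , pu , pv , auv =
    reach-++ (reach-mono (λ w pw → subst S (sym pw) Sl) (part-conn l x u px pu))
             (step auv (subst S (sym pv) Sw) (reach-lift r Sw v y pv py))

  minor-contraction : ∀ H → Minor H W → Minor H X
  minor-contraction H (f , f-onto , f-conn , f-edge) = (λ v → f (part v)) , onto , conn , edges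
    where
    onto : ∀ h → ∃ λ v → f (part v) ≡ just h
    onto h with f-onto h
    ... | l , fl with part-surj l
    ...   | v , refl = v , fl

    conn : ∀ h → ConnectedIn X (λ v → f (part v) ≡ just h)
    conn h x y fx fy = reach-lift (f-conn h (part x) (part y) fx fy) fx x y refl refl

    edges : ∀ h h′ → adj H h h′ ≡ true →
      ∃₂ λ x y → f (part x) ≡ just h × f (part y) ≡ just h′ × adj X x y ≡ true
    edges h h′ a with f-edge h h′ a
    ... | l , l′ , fl , fl′ , al with part-edge l l′ al
    ...   | u , v , refl , refl , auv = u , v , fl , fl′ , auv

factor-minor : ∀ {m} {Gs : Fin m → Graph} (M : MinorSubproduct Gs) j H →
  Minor H (fac M j) → Minor H (Gs j)
factor-minor M j = minor-contraction
  where open Contraction (part M j) (part-surj M j) (part-conn M j) (fac-ok M j)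

-- first P? d: the least i ≤ d with P i, or d itself if there is none.
first : ∀ {k p} {P : Fin k → Set p} → (∀ i → Dec (P i)) → Fin k → Fin k
first {suc k} P? d with P? fzero
... | yes _ = fzero
first {suc k} P? fzero    | no _ = fzero
first {suc k} P? (fsuc d) | no _ = fsuc (first (P? ∘ fsuc) d)

first-satisfies : ∀ {k p} {P : Fin k → Set p} (P? : ∀ i → Dec (P i)) d → P d → P (first P? d)
first-satisfies {suc k} P? d Pd with P? fzero
... | yes P₀ = P₀
first-satisfies {suc k} P? fzero    Pd | no ¬P₀ = contradiction Pd ¬P₀
first-satisfies {suc k} P? (fsuc d) Pd | no _   = first-satisfies (P? ∘ fsuc) d Pd

first-cong : ∀ {k p} {P Q : Fin k → Set p} (P? : ∀ i → Dec (P i)) (Q? : ∀ i → Dec (Q i)) →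
  (∀ i → P i → Q i) → (∀ i → Q i → P i) → ∀ {d e} → P d → Q e → first P? d ≡ first Q? e
first-cong {suc k} P? Q? P⇒Q Q⇒P Pd Qe with P? fzero | Q? fzero
... | yes _  | yes _  = refl
... | yes P₀ | no ¬Q₀ = contradiction (P⇒Q fzero P₀) ¬Q₀
... | no ¬P₀ | yes Q₀ = contradiction (Q⇒P fzero Q₀) ¬P₀
first-cong {suc k} P? Q? P⇒Q Q⇒P {fzero}  Pd Qe | no ¬P₀ | no _ = contradiction Pd ¬P₀
first-cong {suc k} P? Q? P⇒Q Q⇒P {fsuc d} {fzero} Pd Qe | no _ | no ¬Q₀ = contradiction Qe ¬Q₀
first-cong {suc k} P? Q? P⇒Q Q⇒P {fsuc d} {fsuc e} Pd Qe | no _ | no _ =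
  cong fsuc (first-cong (P? ∘ fsuc) (Q? ∘ fsuc) (P⇒Q ∘ fsuc) (Q⇒P ∘ fsuc) Pd Qe)

module Classify {k} {ℓ : Level} {R : Rel (Fin k) ℓ} (isDecEquivalence : IsDecEquivalence R) where
  open IsDecEquivalence isDecEquivalence
    using () renaming (_≟_ to _≈?_; refl to R-refl; sym to R-sym; trans to R-trans)

  label : Fin k → Fin k
  label b = first (_≈? b) b

  label-related : ∀ b → R (label b) b
  label-related b = first-satisfies (_≈? b) b R-refl

  label-complete : ∀ {b c} → R b c → label b ≡ label c
  label-complete b~c =
    first-cong (_≈? _) (_≈? _) (λ a a~b → R-trans a~b b~c) (λ a a~c → R-trans a~c (R-sym b~c)) R-refl R-refl

  label-sound : ∀ {b c} → label b ≡ label c → R b c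
  label-sound {b} {c} eq = R-trans (R-sym (label-related b)) (subst (λ a → R a c) (sym eq) (label-related c))

does-true : ∀ {A : Set} (d : Dec A) → does d ≡ true → A
does-true (yes a) _ = a

∧-true : ∀ {x y} → x ∧ y ≡ true → x ≡ true × y ≡ true
∧-true {true} y≡true = refl , y≡true

adjacent-distinct : ∀ (X : Graph) {x y} → adj X x y ≡ true → x ≢ y
adjacent-distinct X {x} axy refl with trans (sym axy) (adj-irrefl X x)
... | ()

two-vertices : ∀ {k} (x y : Fin k) → x ≢ y → (2 ≤ᵇ k) ≡ true
two-vertices {suc zero}    fzero fzero x≢y = contradiction refl x≢y
two-vertices {suc (suc k)} x     y     x≢y = refl

module Directions {m : ℕ} (Ws : Fin m → Graph) (F : Graph) (φ : Fin (n F) → ProdV Ws)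
  (φ-embedding : SubgraphOfProd F Ws φ) where

  N : ℕ
  N = n F

  φ-injective : ∀ a b → (∀ i → φ a i ≡ φ b i) → a ≡ b
  φ-injective = proj₁ φ-embedding

  φ-adjacent : ∀ a b → adj F a b ≡ true → ProdAdj Ws (φ a) (φ b)
  φ-adjacent = proj₂ φ-embedding

  SameOff : Fin m → Fin N → Fin N → Set
  SameOff j a b = ∀ i → i ≢ j → φ a i ≡ φ b i

  sameOff-sym : ∀ {j a b} → SameOff j a b → SameOff j b a
  sameOff-sym a~b i i≢j = sym (a~b i i≢j)

  sameOff-isDecEquivalence : ∀ j → IsDecEquivalence (SameOff j)
  sameOff-isDecEquivalence j = record
    { isEquivalence = record
      { refl  = λ i i≢j → refl
      ; sym   = sameOff-sym
      ; trans = λ a~b b~c i i≢j → trans (a~b i i≢j) (b~c i i≢j)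
      }
    ; _≟_ = λ a b → all? (λ i → ¬? (i ≟ᶠ j) →-dec (φ a i ≟ᶠ φ b i))
    }

  sameOff? : ∀ j a b → Dec (SameOff j a b)
  sameOff? j = IsDecEquivalence._≟_ (sameOff-isDecEquivalence j)

  fibre : Fin m → Fin N → Fin N
  fibre j = Classify.label (sameOff-isDecEquivalence j)

  along : Fin m → Graph
  along j = record
    { n          = N
    ; adj        = λ a b → adj F a b ∧ does (sameOff? j a b)
    ; adj-sym    = λ a b → cong₂ _∧_ (adj-sym F a b)
                      (does-⇔ (mk⇔ sameOff-sym sameOff-sym) (sameOff? j a b) (sameOff? j b a))
    ; adj-irrefl = λ a → cong (_∧ does (sameOff? j a a)) (adj-irrefl F a)
    }

  fibre-edge : ∀ j a b → adj (along j) a b ≡ true → fibre j a ≡ fibre j b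
  fibre-edge j a b e =
    Classify.label-complete (sameOff-isDecEquivalence j) (does-true (sameOff? j a b) (proj₂ (∧-true e)))

  module _ (j : Fin m) (l : Fin N) where
    open Partition (along j) (fibre j) (fibre-edge j) using (class)

    fibre-embedding : Embedding (induced (along j) (class l)) (Ws j)
    fibre-embedding = record
      { map       = λ u → φ (vertex u) j
      ; injective = injective
      ; preserves = preserves
      }
      where
      vertex : Fin (count (class l)) → Fin N
      vertex = enum (class l)

      in-fibre : ∀ u → fibre j (vertex u) ≡ l
      in-fibre u = does-true (fibre j (vertex u) ≟ᶠ l) (enum-selects (class l) u)

      same-line : ∀ u v → SameOff j (vertex u) (vertex v)
      same-line u v =
        Classify.label-sound (sameOff-isDecEquivalence j) (trans (in-fibre u) (sym (in-fibre v)))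

      injective : ∀ u v → φ (vertex u) j ≡ φ (vertex v) j → u ≡ v
      injective u v eqʲ = enum-injective (class l) u v (φ-injective _ _ coordinatewise)
        where
        coordinatewise : ∀ i → φ (vertex u) i ≡ φ (vertex v) i
        coordinatewise i with i ≟ᶠ j
        ... | yes refl = eqʲ
        ... | no  i≢j  = same-line u v i i≢j

      -- The edge changes some coordinate j′; off j nothing changes, so j′ = j.
      preserves : ∀ u v → adj (along j) (vertex u) (vertex v) ≡ true →
        adj (Ws j) (φ (vertex u) j) (φ (vertex v) j) ≡ true
      preserves u v e with φ-adjacent (vertex u) (vertex v) (proj₁ (∧-true e))
      ... | j′ , a′ , _ with j′ ≟ᶠ j
      ...   | yes refl = a′
      ...   | no  j′≢j = contradiction (same-line u v j′ j′≢j) (adjacent-distinct (Ws j′) a′)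

  direction-sparse : ∀ p q j → (∀ Y → Embedding Y (Ws j) → Sparse p q Y) → Sparse p q (along j)
  direction-sparse p q j factor-sparse = partition-sparse p q (λ l → factor-sparse _ (fibre-embedding j l))
    where open Partition (along j) (fibre j) (fibre-edge j)

  isNontrivial : Fin m → Bool
  isNontrivial j = 2 ≤ᵇ n (Ws j)

  edge-has-direction : ∀ a b → 𝟙 (adj F a b) ≤ ∑[ j < m ] (𝟙 (isNontrivial j) * 𝟙 (adj (along j) a b))
  edge-has-direction a b = 𝟙-≤ counted
    where
    counted : adj F a b ≡ true → 1 ≤ ∑[ j < m ] (𝟙 (isNontrivial j) * 𝟙 (adj (along j) a b))
    counted ab with φ-adjacent a b ab
    ... | j , aʲ , others = ≤-trans (≤-reflexive (sym term≡1)) (∑-term _ j)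
      where
      term≡1 : 𝟙 (isNontrivial j) * 𝟙 (adj (along j) a b) ≡ 1
      term≡1 = cong₂ (λ s t → 𝟙 s * 𝟙 t)
        (two-vertices (φ a j) (φ b j) (adjacent-distinct (Ws j) aʲ))
        (cong₂ _∧_ ab (dec-true (sameOff? j a b) others))

  degSum-by-direction : degSum F ≤ ∑[ j < m ] (𝟙 (isNontrivial j) * degSum (along j))
  degSum-by-direction = begin
    ∑[ a < N ] ∑[ b < N ] 𝟙 (adj F a b)
      ≤⟨ ∑-mono (λ a → ∑-mono (edge-has-direction a)) ⟩
    ∑[ a < N ] ∑[ b < N ] ∑[ j < m ] (c j * 𝟙 (adj (along j) a b))
      ≡⟨ trans (sum-cong-≗ {N} (λ a → ∑-comm {N} {m} _)) (∑-comm {N} {m} _) ⟩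
    ∑[ j < m ] ∑[ a < N ] ∑[ b < N ] (c j * 𝟙 (adj (along j) a b))
      ≡⟨ sum-cong-≗ {m} (λ j → sym (trans (*-distribˡ-sum {N} (c j) _)
                                          (sum-cong-≗ {N} (λ a → *-distribˡ-sum {N} (c j) _)))) ⟩
    ∑[ j < m ] (c j * degSum (along j)) ∎
    where
    open ≤-Reasoning
    c : Fin m → ℕ
    c j = 𝟙 (isNontrivial j)

  product-sparse : ∀ p q → (∀ j Y → Embedding Y (Ws j) → Sparse p q Y) →
    q * (2 * numEdges F) ≤ p * (countFin m isNontrivial * N)
  product-sparse p q factor-sparse = begin
    q * (2 * numEdges F)                   ≡⟨ cong (q *_) (sym (handshake F)) ⟩
    q * degSum F                           ≤⟨ *-monoʳ-≤ q degSum-by-direction ⟩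
    q * ∑[ j < m ] (c j * D j)             ≡⟨ *-distribˡ-sum {m} q _ ⟩
    ∑[ j < m ] (q * (c j * D j))           ≡⟨ sum-cong-≗ {m} (λ j → x∙yz≈y∙xz q (c j) (D j)) ⟩
    ∑[ j < m ] (c j * (q * D j))           ≤⟨ ∑-mono (λ j → *-monoʳ-≤ (c j) (direction-bound j)) ⟩
    ∑[ j < m ] (c j * (p * N))             ≡⟨ sym (*-distribʳ-sum {m} (p * N) c) ⟩
    (∑[ j < m ] c j) * (p * N)             ≡⟨ cong (_* (p * N)) (sym (sumFin≡sum m c)) ⟩
    countFin m isNontrivial * (p * N)      ≡⟨ x∙yz≈y∙xz (countFin m isNontrivial) p N ⟩
    p * (countFin m isNontrivial * N)      ∎
    where
    open ≤-Reasoning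
    c : Fin m → ℕ
    c j = 𝟙 (isNontrivial j)
    D : Fin m → ℕ
    D j = degSum (along j)
    direction-bound : ∀ j → q * D j ≤ p * N
    direction-bound j = sparse-degSum p q (along j) (direction-sparse p q j (factor-sparse j))

-- The theorem: M itself witnesses the bound.  Graphs embedding into a
-- factor M_j are H-minor-free, because M_j is a minor of G_j.
lemma6p2 : (H : Graph) (p q : ℕ) → 0 < q →
    (∀ (F : Graph) → ¬ Minor H F → q * (2 * numEdges F) ≤ p * n F) →
    (m : ℕ) (Gs : Fin m → Graph) →
    (∀ i → Connected (Gs i)) → (∀ i → ¬ Minor H (Gs i)) →
    (G : Graph) (ψ : Fin (n G) → ProdV Gs) → SubgraphOfProd G Gs ψ →
    (M : MinorSubproduct Gs) → Shattered G ψ M →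
    (F : Graph) (φ : Fin (n F) → ProdV (fac M)) → SubgraphOfProd F (fac M) φ →
    0 < n F →
    Σ (MinorSubproduct Gs) λ M′ → Shattered G ψ M′ ×
      (q * (2 * numEdges F) ≤ p * (nontrivial M′ * n F))
lemma6p2 H p q _ H-free-sparse m Gs _ Gs-H-free G ψ _ M shattered F φ F⊆M _ =
  M , shattered , Directions.product-sparse (fac M) F φ F⊆M p q factor-sparse
  where
  factor-sparse : ∀ j Y → Embedding Y (fac M j) → Sparse p q Y
  factor-sparse j Y Y↪Mⱼ =
    H-free-sparse Y (λ H≼Y → Gs-H-free j (factor-minor M j H (minor-embedding Y↪Mⱼ H H≼Y)))
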